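{- Let $G$ be the infinite grid graph with vertex set $\mathbb{Z}^2$, $\sigma$ a distinguished face, and $k$ a nonnegative integer. Let $K$ be the face configuration with $K_\sigma=k$ and $K_\tau=0$ for all faces $\tau\ne\sigma$. If $K^*$ is any configuration reachable from $K$ by the flow-firing process for $(G,\sigma)$ in the face representation, then for every face $\tau\neq\sigma$, $$K^*_\tau\le \max\{0,\,k-\mathrm{dist}(\sigma,\tau)+1\}.$$
   Context: Faces of $G$ are the unit squares of $\mathbb{Z}^2$; two faces are neighbors if they share an edge. $\mathrm{dist}(\sigma,\tau)$ is the distance from $\sigma$ to $\tau$ in the dual graph of $G$ (faces as vertices, neighbors adjacent), i.e. the Manhattan distance between the squares. A face configuration assigns an integer $F_\tau$ to each face. Flow-firing process for $(G,\sigma)$ in the face representation: at each step choose two neighboring faces $a,b$, and: if $a\neq\sigma$, $b\neq\sigma$ and $F_a\ge F_b+2$, replace $F_a$ by $F_a-1$ and $F_b$ by $F_b+1$; if $b=\sigma$ and $F_\sigma>F_a$, replace $F_a$ by $F_a+1$; if $b=\sigma$ and $F_\sigma<F_a$, replace $F_a$ by $F_a-1$. No other moves are allowed. (Equivalently, $K$ corresponds to $k$ units of edge flow circulating around $\sigma$, where flow on edges of $\sigma$ may only be rerouted across the other face containing them.) -}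

module Defs where

open import Data.Integer using (ℤ; +_; _+_; _-_; _≤_; _<_; ∣_∣; 0ℤ; 1ℤ)
open import Data.Integer.Properties using (_≟_)
open import Data.Nat using (ℕ) renaming (_+_ to _+ℕ_)
open import Data.Product using (_×_; _,_; proj₁; proj₂)
open import Data.Product.Properties using (≡-dec)
open import Relation.Nullary using (¬_; yes; no; Dec)
open import Relation.Binary.PropositionalEquality using (_≡_)
open import Relation.Binary.Construct.Closure.ReflexiveTransitive using (Star)

-- A face (unit square of the grid Z^2) is identified with its lower-left corner.
Face : Set
Face = ℤ × ℤ

_≟F_ : (a b : Face) → Dec (a ≡ b)
_≟F_ = ≡-dec _≟_ _≟_

data Neighbor : Face → Face → Set where
  right : ∀ x y → Neighbor (x , y) (x + 1ℤ , y)
  left  : ∀ x y → Neighbor (x , y) (x - 1ℤ , y)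
  up    : ∀ x y → Neighbor (x , y) (x , y + 1ℤ)
  down  : ∀ x y → Neighbor (x , y) (x , y - 1ℤ)

-- Distance in the dual graph = Manhattan distance of the squares.
dist : Face → Face → ℕ
dist (a , b) (c , d) = ∣ a - c ∣ +ℕ ∣ b - d ∣

Config : Set
Config = Face → ℤ

update : Config → Face → ℤ → Config
update F a v t with t ≟F a
... | yes _ = v
... | no  _ = F t

data Step (σ : Face) : Config → Config → Set where
  fire : ∀ {F a b} → Neighbor a b → ¬ a ≡ σ → ¬ b ≡ σ →
         F b + (+ 2) ≤ F a →
         Step σ F (update (update F a (F a - 1ℤ)) b (F b + 1ℤ))
  toσ-up : ∀ {F a} → Neighbor a σ → F a < F σ →
         Step σ F (update F a (F a + 1ℤ))
  toσ-down : ∀ {F a} → Neighbor a σ → F σ < F a →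
         Step σ F (update F a (F a - 1ℤ))

Reachable : Face → Config → Config → Set
Reachable σ = Star (Step σ)

initial : Face → ℕ → Config
initial σ k = update (λ _ → 0ℤ) σ (+ k)

module Submission where

-- Put  envelope σ k τ = (k + 1) ∸ dist σ τ.  We show that the
-- following invariant holds for K and is preserved by every move of the
-- flow-firing process, hence holds for every reachable K*:
--   (a) the value at σ is k (no move ever changes F σ), and
--   (b) F τ ≤ envelope σ k τ for every face τ ≠ σ.
-- Moves that lower a value cannot break (b).  A move that raises F b is
--   * a firing from a neighbour a of b with F b + 2 ≤ F a; since dist is a
--     metric and neighbours are at distance 1, envelope a ≤ envelope b + 1,
--     so F b + 1 ≤ F a - 1 ≤ envelope b;
--   * a move towards σ at a neighbour b of σ with F b < F σ = k; since
--     dist σ b = 1, envelope b = k, so F b + 1 ≤ envelope b.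

open import Defs
open import Data.Nat using (ℕ; _∸_) renaming (_+_ to _+ℕ_)
open import Data.Integer using (ℤ; +_; _≤_; _+_; _-_; -_; ∣_∣; 0ℤ; 1ℤ; -1ℤ; +≤+)
import Data.Integer.Properties as ℤ
import Data.Nat as ℕ
import Data.Nat.Properties as ℕ
open import Data.Integer.Tactic.RingSolver using (solve-∀)
open import Data.Nat.Tactic.RingSolver renaming (solve-∀ to solveℕ-∀)
open import Data.Product using (_×_; _,_; proj₂)
open import Data.Empty using (⊥-elim)
open import Function using (_∘_)
open import Relation.Nullary using (¬_; yes; no)
open import Relation.Binary.PropositionalEquality
  using (_≡_; refl; sym; trans; cong; subst; subst₂)
open import Relation.Binary.Construct.Closure.ReflexiveTransitive using (fold)

update-at : ∀ F a v → update F a v a ≡ v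
update-at F a v with a ≟F a
... | yes _ = refl
... | no a≢a = ⊥-elim (a≢a refl)

update-elsewhere : ∀ F a v {τ} → ¬ τ ≡ a → update F a v τ ≡ F τ
update-elsewhere F a v {τ} τ≢a with τ ≟F a
... | yes τ≡a = ⊥-elim (τ≢a τ≡a)
... | no _ = refl

_≤_off_ : Config → Config → Face → Set
F ≤ B off σ = ∀ τ → ¬ τ ≡ σ → F τ ≤ B τ

update-≤-off : ∀ {F B σ} a {v} → F ≤ B off σ → v ≤ B a → update F a v ≤ B off σ
update-≤-off a F≤B v≤Ba τ τ≢σ with τ ≟F a
... | yes refl = v≤Ba
... | no _ = F≤B τ τ≢σ

dist-self : ∀ a → dist a a ≡ 0
dist-self (x , y) rewrite ℤ.+-inverseʳ x | ℤ.+-inverseʳ y = refl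

dist-sym : ∀ a b → dist a b ≡ dist b a
dist-sym (x , y) (x′ , y′) rewrite ℤ.∣i-j∣≡∣j-i∣ x x′ | ℤ.∣i-j∣≡∣j-i∣ y y′ = refl

∣-∣-triangle : ∀ i j l → ∣ i - l ∣ ℕ.≤ ∣ i - j ∣ +ℕ ∣ j - l ∣
∣-∣-triangle i j l = subst (λ z → ∣ z ∣ ℕ.≤ ∣ i - j ∣ +ℕ ∣ j - l ∣) (telescope i j l) (ℤ.∣i+j∣≤∣i∣+∣j∣ (i - j) (j - l))
  where
  telescope : ∀ i j l → (i - j) + (j - l) ≡ i - l
  telescope = solve-∀

dist-triangle : ∀ a b c → dist a c ℕ.≤ dist a b +ℕ dist b c
dist-triangle (x₁ , y₁) (x₂ , y₂) (x₃ , y₃) =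
  subst (dist (x₁ , y₁) (x₃ , y₃) ℕ.≤_) (interchange (∣ x₁ - x₂ ∣) (∣ x₂ - x₃ ∣) (∣ y₁ - y₂ ∣) (∣ y₂ - y₃ ∣))
    (ℕ.+-mono-≤ (∣-∣-triangle x₁ x₂ x₃) (∣-∣-triangle y₁ y₂ y₃))
  where
  interchange : ∀ m n o p → (m +ℕ n) +ℕ (o +ℕ p) ≡ (m +ℕ o) +ℕ (n +ℕ p)
  interchange = solveℕ-∀

offset-forward : ∀ x d → x - (x + d) ≡ - d
offset-forward = solve-∀

offset-backward : ∀ x d → x - (x - d) ≡ d
offset-backward = solve-∀

dist-neighbor : ∀ {a b} → Neighbor a b → dist a b ≡ 1
dist-neighbor (right x y) rewrite offset-forward x 1ℤ  | ℤ.+-inverseʳ y = refl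
dist-neighbor (left x y)  rewrite offset-backward x 1ℤ | ℤ.+-inverseʳ y = refl
dist-neighbor (up x y)    rewrite ℤ.+-inverseʳ x | offset-forward y 1ℤ  = refl
dist-neighbor (down x y)  rewrite ℤ.+-inverseʳ x | offset-backward y 1ℤ = refl

neighbor-distinct : ∀ {a b} → Neighbor a b → ¬ a ≡ b
neighbor-distinct {a} nb refl with trans (sym (dist-self a)) (dist-neighbor nb)
... | ()

dist-neighbor-≤ : ∀ σ {a b} → Neighbor a b → dist σ b ℕ.≤ ℕ.suc (dist σ a)
dist-neighbor-≤ σ {a} {b} nb =
  subst (dist σ b ℕ.≤_) (trans (cong (dist σ a +ℕ_) (dist-neighbor nb)) (ℕ.+-comm (dist σ a) 1))
    (dist-triangle σ a b)

dist-neighbor-≥ : ∀ σ {a b} → Neighbor a b → dist σ a ℕ.≤ ℕ.suc (dist σ b)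
dist-neighbor-≥ σ {a} {b} nb =
  subst (dist σ a ℕ.≤_)
    (trans (cong (dist σ b +ℕ_) (trans (dist-sym b a) (dist-neighbor nb))) (ℕ.+-comm (dist σ b) 1))
    (dist-triangle σ b a)

envelope : Face → ℕ → Face → ℕ
envelope σ k τ = (k +ℕ 1) ∸ dist σ τ

∸-suc-≤ : ∀ m n → m ∸ n ℕ.≤ ℕ.suc (m ∸ ℕ.suc n)
∸-suc-≤ ℕ.zero    ℕ.zero    = ℕ.z≤n
∸-suc-≤ ℕ.zero    (ℕ.suc n) = ℕ.z≤n
∸-suc-≤ (ℕ.suc m) ℕ.zero    = ℕ.≤-refl
∸-suc-≤ (ℕ.suc m) (ℕ.suc n) = ∸-suc-≤ m n

envelope-neighbor : ∀ σ k {a b} → Neighbor a b → envelope σ k a ℕ.≤ ℕ.suc (envelope σ k b)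
envelope-neighbor σ k {a} nb =
  ℕ.≤-trans (∸-suc-≤ (k +ℕ 1) (dist σ a)) (ℕ.s≤s (ℕ.∸-monoʳ-≤ (k +ℕ 1) (dist-neighbor-≤ σ nb)))

envelope-next-to-σ : ∀ σ k {a} → Neighbor a σ → k ℕ.≤ envelope σ k a
envelope-next-to-σ σ k {a} nb =
  subst (ℕ._≤ envelope σ k a) (ℕ.m+n∸n≡m k 1) (ℕ.∸-monoʳ-≤ (k +ℕ 1) dist≤1)
  where
  dist≤1 : dist σ a ℕ.≤ 1
  dist≤1 = subst (λ d → dist σ a ℕ.≤ ℕ.suc d) (dist-self σ) (dist-neighbor-≥ σ nb)

Invariant : Face → ℕ → Config → Set
Invariant σ k F = (F σ ≡ + k) × (F ≤ (λ τ → + envelope σ k τ) off σ)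

minus-one-≤ : ∀ x → x - 1ℤ ≤ x
minus-one-≤ x = ℤ.i-j≤i x 1ℤ

fire-receiver-≤ : ∀ x y → x + + 2 ≤ 1ℤ + y → x + 1ℤ ≤ y
fire-receiver-≤ x y x+2≤1+y = subst₂ _≤_ (pred-[x+2] x) (ℤ.pred-suc y) (ℤ.pred-mono x+2≤1+y)
  where
  pred-[x+2] : ∀ x → -1ℤ + (x + + 2) ≡ x + 1ℤ
  pred-[x+2] = solve-∀

step-preserves : ∀ {σ k F G} → Step σ F G → Invariant σ k F → Invariant σ k G
step-preserves {σ} {k} {F} (fire {a = a} {b} nb a≢σ b≢σ Fb+2≤Fa) (Fσ≡k , F≤env) =
  trans (update-elsewhere _ b _ (b≢σ ∘ sym)) (trans (update-elsewhere F a _ (a≢σ ∘ sym)) Fσ≡k) ,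
  update-≤-off b (update-≤-off a F≤env lowered) raised
  where
  lowered : F a - 1ℤ ≤ + envelope σ k a
  lowered = ℤ.≤-trans (minus-one-≤ (F a)) (F≤env a a≢σ)
  raised : F b + 1ℤ ≤ + envelope σ k b
  raised = fire-receiver-≤ (F b) _
    (ℤ.≤-trans Fb+2≤Fa (ℤ.≤-trans (F≤env a a≢σ) (+≤+ (envelope-neighbor σ k nb))))
step-preserves {σ} {k} {F} (toσ-up {a = a} nb Fa<Fσ) (Fσ≡k , F≤env) =
  trans (update-elsewhere F a _ (neighbor-distinct nb ∘ sym)) Fσ≡k ,
  update-≤-off a F≤env raised
  where
  raised : F a + 1ℤ ≤ + envelope σ k a
  raised = subst (_≤ _) (ℤ.+-comm 1ℤ (F a))
    (ℤ.≤-trans (ℤ.i<j⇒suc[i]≤j Fa<Fσ)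
      (subst (_≤ _) (sym Fσ≡k) (+≤+ (envelope-next-to-σ σ k nb))))
step-preserves {σ} {k} {F} (toσ-down {a = a} nb Fσ<Fa) (Fσ≡k , F≤env) =
  trans (update-elsewhere F a _ (neighbor-distinct nb ∘ sym)) Fσ≡k ,
  update-≤-off a F≤env (ℤ.≤-trans (minus-one-≤ (F a)) (F≤env a (neighbor-distinct nb)))

reachable-preserves : ∀ {σ k F G} → Reachable σ F G → Invariant σ k F → Invariant σ k G
reachable-preserves {σ} {k} =
  fold (λ F G → Invariant σ k F → Invariant σ k G) (λ s rest → rest ∘ step-preserves s) (λ inv → inv)

initial-invariant : ∀ σ k → Invariant σ k (initial σ k)
initial-invariant σ k =
  update-at _ σ _ ,
  λ τ τ≢σ → subst (_≤ + envelope σ k τ) (sym (update-elsewhere (λ _ → 0ℤ) σ (+ k) τ≢σ)) (+≤+ ℕ.z≤n)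

lemma6p2 : (σ : Face) (k : ℕ) (K* : Config) →
    Reachable σ (initial σ k) K* →
    (τ : Face) → ¬ τ ≡ σ →
    K* τ ≤ + ((k +ℕ 1) ∸ dist σ τ)
lemma6p2 σ k K* reach = proj₂ (reachable-preserves reach (initial-invariant σ k))
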